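{- Let $D=(V,A)$ be a finite simple digraph with vertex set $V=\{v_1,\dots,v_n\}$, and let $G=(X,Y;E)$ be its Z-mapping graph. A set of arcs $L\subseteq A$ is the arc set of a Hamiltonian cycle of $D$ if and only if the set $M\subseteq E$ of edges of $G$ corresponding to $L$ is a perfect matching of $G$ and the incidence matrix of the spanning subdigraph $(V,L)$ has rank $n-1$.
   Context: The incidence matrix of a digraph $(V,B)$ with $V=\{v_1,\dots,v_n\}$ and arcs $b_1,\dots,b_k$ is the $n\times k$ matrix $C=(c_{ij})$ with $c_{ij}=1$ if $v_i$ is the tail of $b_j$, $c_{ij}=-1$ if $v_i$ is the head of $b_j$, and $c_{ij}=0$ otherwise; rank is the usual matrix rank. The Z-mapping graph of $D$ is the bipartite graph $G=(X,Y;E)$ with $X=\{x_1,\dots,x_n\}$, $Y=\{y_1,\dots,y_n\}$, and one edge $x_iy_k\in E$ for each arc $\langle v_i,v_k\rangle\in A$; this gives a bijection between arcs of $D$ and edges of $G$. A perfect matching of $G$ is a set of $n$ pairwise disjoint edges. A Hamiltonian cycle of $D$ is a directed simple cycle through all $n\ge 2$ vertices. -}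

module Defs where

open import Data.Nat using (ℕ; zero; suc; _<?_; _≤_; _+_)
open import Data.Fin using (Fin; toℕ; fromℕ<; _≟_)
import Data.Fin as F
open import Data.Bool using (Bool; true; false; if_then_else_)
open import Data.List using (List; []; _∷_; length; map; foldr; allFin; lookup)
open import Data.Product using (_×_; _,_; Σ; ∃; ∃-syntax; proj₁; proj₂)
open import Data.Rational using (ℚ; 0ℚ; 1ℚ; -_) renaming (_+_ to _+ℚ_; _*_ to _*ℚ_)
open import Data.List.Membership.Propositional using (_∈_)
open import Relation.Binary.PropositionalEquality using (_≡_)
open import Relation.Nullary using (¬_; yes; no)
open import Function.Definitions using (Injective)

-- Digraphs on the vertex set V = {v_1,…,v_n}, represented as Fin n.
-- An arc ⟨v_i , v_k⟩ is present iff A i k ≡ true.  A relation cannot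
-- carry parallel arcs, so "simple" amounts to: no loops.

Digraph : ℕ → Set
Digraph n = Fin n → Fin n → Bool

Simple : ∀ {n} → Digraph n → Set
Simple {n} A = (i : Fin n) → A i i ≡ false

_⊆ᵃ_ : ∀ {n} → Digraph n → Digraph n → Set
_⊆ᵃ_ {n} L A = (i k : Fin n) → L i k ≡ true → A i k ≡ true

-- A directed simple cycle through all n vertices is
-- given by an injective (hence bijective) enumeration π of the vertices:
-- π 0 → π 1 → … → π (n-1) → π 0.  Its arc set is the set of arcs
-- ⟨π i , π (i+1 mod n)⟩.

nextMod : ∀ {n} → Fin n → Fin n
nextMod {suc m} i with suc (toℕ i) <? suc m
... | yes p = fromℕ< p
... | no _  = F.zero

IsHamCycleArcSet : ∀ {n} → Digraph n → Set
IsHamCycleArcSet {n} L =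
  Σ (Fin n → Fin n) λ π →
    Injective _≡_ _≡_ π ×
    ((u v : Fin n) → (L u v ≡ true → ∃[ i ] (π i ≡ u × π (nextMod i) ≡ v))
                   × (∃[ i ] (π i ≡ u × π (nextMod i) ≡ v) → L u v ≡ true))

-- Bipartite graphs G = (X, Y; E) with X = {x_1..x_n}, Y = {y_1..y_n};
-- E i k ≡ true iff x_i y_k ∈ E.  Edge subsets have the same shape.

record Bipartite (n : ℕ) : Set where
  field
    edge : Fin n → Fin n → Bool
open Bipartite public

-- Z-mapping graph: one edge x_i y_k for each arc ⟨v_i , v_k⟩.
ZMapping : ∀ {n} → Digraph n → Bipartite n
ZMapping A = record { edge = A }

correspondingEdges : ∀ {n} → Digraph n → (Fin n → Fin n → Bool)
correspondingEdges L = λ i k → L i k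

countB : ∀ {n} → (Fin n → Fin n → Bool) → ℕ
countB {n} M =
  foldr _+_ 0 (map (λ i → foldr _+_ 0
     (map (λ k → if M i k then 1 else 0) (allFin n))) (allFin n))

IsPerfectMatching : ∀ {n} → Bipartite n → (Fin n → Fin n → Bool) → Set
IsPerfectMatching {n} G M =
  ((i k : Fin n) → M i k ≡ true → edge G i k ≡ true) ×
  countB M ≡ n ×
  ((i k i' k' : Fin n) → M i k ≡ true → M i' k' ≡ true →
     ¬ ((i , k) ≡ (i' , k')) → ¬ (i ≡ i') × ¬ (k ≡ k'))

-- Columns are indexed by the arcs of (V, L) (the order of
-- columns is irrelevant for rank).

incCol : ∀ {n} → Fin n × Fin n → Fin n → ℚ
incCol (u , v) w with w ≟ u
... | yes _ = 1ℚ
... | no _ with w ≟ v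
...   | yes _ = - 1ℚ
...   | no _  = 0ℚ

sumℚ : List ℚ → ℚ
sumℚ = foldr _+ℚ_ 0ℚ

LinIndepArcs : ∀ {n} → List (Fin n × Fin n) → Set
LinIndepArcs {n} bs =
  (c : Fin (length bs) → ℚ) →
  ((w : Fin n) → sumℚ (map (λ j → c j *ℚ incCol (lookup bs j) w)
                           (allFin (length bs))) ≡ 0ℚ) →
  (j : Fin (length bs)) → c j ≡ 0ℚ

ArcListOf : ∀ {n} → Digraph n → List (Fin n × Fin n) → Set
ArcListOf {n} L bs = (b : Fin n × Fin n) → b ∈ bs → L (proj₁ b) (proj₂ b) ≡ true

IncidenceRank : ∀ {n} → Digraph n → ℕ → Set
IncidenceRank {n} L r =
  (Σ (List (Fin n × Fin n)) λ bs → ArcListOf L bs × LinIndepArcs bs × length bs ≡ r) ×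
  ((bs : List (Fin n × Fin n)) → ArcListOf L bs → LinIndepArcs bs → length bs ≤ r)

-- Call σ a successor function of an arc set L if u → v is an arc of L exactly
-- when v = σ u.  The proof expresses all three conditions through σ:
--  * the edges of L form a perfect matching of the Z-mapping graph iff L has an
--    injective successor function (one edge at each x_i and at each y_k); in a
--    simple digraph it has no fixed points;
--  * L is a Hamiltonian cycle iff it has a successor function σ with a cyclic
--    order, a bijection π with π (i + 1 mod n) = σ (π i);
--  * for a fixed-point-free injective σ, the columns with tail in a σ-invariant
--    set S sum to zero whenever every vertex of S is a tail.  So at most n − 1
--    arcs are independent, and if n − 1 are, every nonempty invariant set (in
--    particular every orbit) is everything, i.e. σ is a single n-cycle.
--    Conversely the path π 0 → … → π (n − 1) of a cyclic order is independent,
--    its columns being in echelon form.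
module Submission where

open import Defs
open import Algebra.Bundles using (CommutativeMonoid)
open import Data.Bool using (Bool; true; false; if_then_else_)
import Data.Bool.Properties as BP
open import Data.Nat as ℕ using (ℕ; zero; suc; _+_; _∸_; _≤_; _<_; _<?_; z≤n; s≤s)
import Data.Nat.Properties as NP
open import Data.Nat.GeneralisedArithmetic using (fold; fold-+)
open import Data.Fin as F using (Fin; toℕ; fromℕ<; punchIn; punchOut)
import Data.Fin.Properties as FP
import Data.Fin.Induction as FI
open import Data.List using (List; []; _∷_; length; map; foldr; allFin; lookup; tabulate)
open import Data.List.Properties using (map-tabulate)
open import Data.List.Membership.Propositional using (_∈_)
open import Data.List.Membership.Propositional.Properties using (∈-lookup)
open import Data.List.Relation.Unary.Any using (here; there)
open import Data.Product using (Σ; ∃; ∃₂; _×_; _,_; proj₁; proj₂)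
open import Data.Rational using (ℚ; 0ℚ; 1ℚ; -_)
  renaming (_+_ to _+ℚ_; _*_ to _*ℚ_; _-_ to _-ℚ_)
import Data.Rational.Properties as QP
open import Data.Sum using (_⊎_; inj₁; inj₂; [_,_]′)
open import Data.Unit using (⊤; tt)
open import Data.Vec.Functional using (Vector; removeAt)
import Data.Vec.Functional as Vector
open import Function using (id; _∘_)
open import Function.Bundles using (_⇔_; mk⇔)
open import Function.Definitions using (Injective)
open import Induction.WellFounded using (module All)
open import Relation.Binary.Definitions using (tri<; tri≈; tri>)
open import Relation.Binary.PropositionalEquality
open import Relation.Nullary using (¬_; Dec; yes; no; ¬?; _×-dec_)
open import Relation.Nullary.Negation using (contradiction)

-- Sums in Defs fold a list over allFin k; the library's sums fold a vector
-- Fin k → A.  Both folds agree.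
foldr-tabulate : ∀ {A B : Set} (_∙_ : A → B → B) (e : B) {k} (f : Fin k → A) →
                 foldr _∙_ e (tabulate f) ≡ Vector.foldr _∙_ e f
foldr-tabulate _∙_ e {zero} f = refl
foldr-tabulate _∙_ e {suc k} f = cong (f F.zero ∙_) (foldr-tabulate _∙_ e (f ∘ F.suc))

foldr-map-allFin : ∀ {A B : Set} (_∙_ : A → B → B) (e : B) {k} (f : Fin k → A) →
                   foldr _∙_ e (map f (allFin k)) ≡ Vector.foldr _∙_ e f
foldr-map-allFin _∙_ e {k} f =
  trans (cong (foldr _∙_ e) (map-tabulate id f)) (foldr-tabulate _∙_ e f)

module FiniteSums {c ℓ} (M : CommutativeMonoid c ℓ) where

  open CommutativeMonoid M using (Carrier; _≈_; _∙_; ε; ∙-congˡ; identityʳ)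
    renaming (setoid to ≈-setoid; trans to ≈-trans)
  open import Algebra.Properties.CommutativeMonoid.Sum M using (sum-cong-≋; sum-replicate-zero)
  open import Algebra.Properties.CommutativeMonoid.Sum M public using (sum; sum-cong-≗; sum-remove)
  open import Relation.Binary.Reasoning.Setoid ≈-setoid

  sum-zero : ∀ {k} (f : Vector Carrier k) → (∀ j → f j ≈ ε) → sum f ≈ ε
  sum-zero {k} f f≈0 = ≈-trans (sum-cong-≋ f≈0) (sum-replicate-zero k)

  sum-single : ∀ {k} (f : Vector Carrier k) (a : Fin k) →
               (∀ j → j ≢ a → f j ≈ ε) → sum f ≈ f a
  sum-single {suc k} f a off = begin
    sum f                    ≈⟨ sum-remove f ⟩
    f a ∙ sum (removeAt f a) ≈⟨ ∙-congˡ (sum-zero (removeAt f a) (λ j → off _ (FP.punchInᵢ≢i a j))) ⟩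
    f a ∙ ε                  ≈⟨ identityʳ (f a) ⟩
    f a                      ∎

  sum-pair : ∀ {k} (f : Vector Carrier k) (a b : Fin k) → a ≢ b →
             (∀ j → j ≢ a → j ≢ b → f j ≈ ε) → sum f ≈ f a ∙ f b
  sum-pair {suc k} f a b a≢b off = begin
    sum f                    ≈⟨ sum-remove f ⟩
    f a ∙ sum (removeAt f a) ≈⟨ ∙-congˡ (sum-single (removeAt f a) b′ off′) ⟩
    f a ∙ f (punchIn a b′)   ≡⟨ cong (λ x → f a ∙ f x) (FP.punchIn-punchOut a≢b) ⟩
    f a ∙ f b                ∎
    where
    b′ : Fin k
    b′ = punchOut a≢b
    off′ : ∀ j → j ≢ b′ → f (punchIn a j) ≈ ε
    off′ j j≢b′ = off _ (FP.punchInᵢ≢i a j)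
                    (λ e → j≢b′ (trans (sym (FP.punchOut-punchIn a)) (FP.punchOut-cong a e)))

module ℚΣ = FiniteSums QP.+-0-commutativeMonoid
open ℚΣ using () renaming (sum to ∑ℚ)

module ℕΣ = FiniteSums NP.+-0-commutativeMonoid
open ℕΣ using () renaming (sum to ∑ℕ)

sum-ones : ∀ {k} (f : Fin k → ℕ) → (∀ j → f j ≡ 1) → ∑ℕ f ≡ k
sum-ones {zero}  f ones = refl
sum-ones {suc k} f ones = cong₂ _+_ (ones F.zero) (sum-ones (f ∘ F.suc) (ones ∘ F.suc))

sum-≤ : ∀ {k} (f : Fin k → ℕ) → (∀ j → f j ≤ 1) → ∑ℕ f ≤ k
sum-≤ {zero}  f ≤1 = z≤n
sum-≤ {suc k} f ≤1 = NP.+-mono-≤ (≤1 F.zero) (sum-≤ (f ∘ F.suc) (≤1 ∘ F.suc))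

saturated : ∀ {k} (f : Fin k → ℕ) → (∀ j → f j ≤ 1) → ∑ℕ f ≡ k → ∀ j → f j ≡ 1
saturated {suc k} f ≤1 total j with f j in fj | ≤1 j
... | 1           | _             = refl
... | suc (suc _) | s≤s ()
... | 0           | _             = contradiction (begin
      suc k                   ≡⟨ total ⟨
      ∑ℕ f                    ≡⟨ ℕΣ.sum-remove {i = j} f ⟩
      f j + ∑ℕ (removeAt f j) ≡⟨ cong (_+ ∑ℕ (removeAt f j)) fj ⟩
      ∑ℕ (removeAt f j)       ≤⟨ sum-≤ (removeAt f j) (≤1 ∘ F.punchIn j) ⟩
      k                       ∎) NP.1+n≰n
  where open NP.≤-Reasoning

Hits : ∀ {k n} → (Fin k → Fin n) → Fin n → Set
Hits f w = ∃ λ i → f i ≡ w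

hits? : ∀ {k n} (f : Fin k → Fin n) (w : Fin n) → Dec (Hits f w)
hits? f w = FP.any? (λ i → f i FP.≟ w)

missed : ∀ {k n} {f : Fin k → Fin n} {t : Fin n} → ¬ Hits f t → ∀ i → t ≢ f i
missed miss i t≡fi = miss (i , sym t≡fi)

squeeze : ∀ {k m} (f : Fin k → Fin (suc m)) (t : Fin (suc m)) → ¬ Hits f t → Fin k → Fin m
squeeze f t miss i = punchOut (missed miss i)

squeeze-injective : ∀ {k m} (f : Fin k → Fin (suc m)) (t : Fin (suc m)) (miss : ¬ Hits f t) →
                    Injective _≡_ _≡_ f → Injective _≡_ _≡_ (squeeze f t miss)
squeeze-injective f t miss f-inj {x} {y} e =
  f-inj (FP.punchOut-injective (missed miss x) (missed miss y) e)

injective⇒surjective : ∀ {k n} (f : Fin k → Fin n) → Injective _≡_ _≡_ f → n ≤ k →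
                       ∀ w → Hits f w
injective⇒surjective {n = suc m} f f-inj n≤k w with hits? f w
... | yes hit = hit
... | no miss = contradiction n≤k (NP.≤⇒≯ (FP.injective⇒≤ (squeeze-injective f w miss f-inj)))

injective-misses-one : ∀ {k m} (f : Fin k → Fin (suc m)) → Injective _≡_ _≡_ f → m ≤ k →
                       ∀ u t → u ≢ t → Hits f u ⊎ Hits f t
injective-misses-one f f-inj m≤k u t u≢t with hits? f t
... | yes hit = inj₂ hit
... | no miss with injective⇒surjective (squeeze f t miss) (squeeze-injective f t miss f-inj) m≤k
                     (punchOut (u≢t ∘ sym))
...   | i , e = inj₁ (i , FP.punchOut-injective (missed miss i) (u≢t ∘ sym) e)

injective-covers-side : ∀ {k m} (f : Fin k → Fin (suc m)) → Injective _≡_ _≡_ f → m ≤ k →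
                        ∀ {S : Fin (suc m) → Set} → (∀ u → Dec (S u)) →
                        (∀ u → S u → Hits f u) ⊎ (∀ u → ¬ S u → Hits f u)
injective-covers-side f f-inj m≤k {S} S? with FP.any? (λ u → S? u ×-dec ¬? (hits? f u))
... | yes (t , St , miss) = inj₂ λ u ¬Su →
  [ id , (λ hit → contradiction hit miss) ]′
    (injective-misses-one f f-inj m≤k u t (λ u≡t → ¬Su (subst S (sym u≡t) St)))
... | no no-miss = inj₁ covered
  where
  covered : ∀ u → S u → Hits f u
  covered u Su with hits? f u
  ... | yes hit  = hit
  ... | no miss  = contradiction (u , Su , miss) no-miss

-- A surjective endomap of a finite set is injective: a section of it is injective,
-- hence onto, hence a two-sided inverse.
surjective⇒injective : ∀ {n} (f : Fin n → Fin n) → (∀ w → Hits f w) → Injective _≡_ _≡_ f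
surjective⇒injective {n} f onto {x} {y} fx≡fy = begin
    x                      ≡⟨ proj₂ (g-onto x) ⟨
    g (proj₁ (g-onto x))   ≡⟨ cong g preimages-equal ⟩
    g (proj₁ (g-onto y))   ≡⟨ proj₂ (g-onto y) ⟩
    y                      ∎
  where
  open ≡-Reasoning
  g : Fin n → Fin n
  g w = proj₁ (onto w)
  f∘g : ∀ w → f (g w) ≡ w
  f∘g w = proj₂ (onto w)
  g-onto : ∀ x → Hits g x
  g-onto = injective⇒surjective g (λ {a} {b} e → trans (sym (f∘g a)) (trans (cong f e) (f∘g b)))
                                  NP.≤-refl
  preimages-equal : proj₁ (g-onto x) ≡ proj₁ (g-onto y)
  preimages-equal = begin
    proj₁ (g-onto x)         ≡⟨ f∘g _ ⟨
    f (g (proj₁ (g-onto x))) ≡⟨ cong f (proj₂ (g-onto x)) ⟩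
    f x                      ≡⟨ fx≡fy ⟩
    f y                      ≡⟨ cong f (proj₂ (g-onto y)) ⟨
    f (g (proj₁ (g-onto y))) ≡⟨ f∘g _ ⟩
    proj₁ (g-onto y)         ∎

nextMod-cases : ∀ {m} (i : Fin (suc m)) →
                (Σ (suc (toℕ i) < suc m) λ p → nextMod i ≡ fromℕ< p)
                ⊎ (toℕ i ≡ m × nextMod i ≡ F.zero)
nextMod-cases {m} i with suc (toℕ i) <? suc m
... | yes p = inj₁ (p , refl)
... | no ¬p = inj₂ (NP.≤-antisym (ℕ.s≤s⁻¹ (FP.toℕ<n i)) (ℕ.s≤s⁻¹ (NP.≮⇒≥ ¬p)) , refl)

nextMod-injective : ∀ {n} → Injective _≡_ _≡_ (nextMod {n})
nextMod-injective {suc m} {i} {j} e with nextMod-cases i | nextMod-cases j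
... | inj₁ (p , ei) | inj₁ (q , ej) =
  FP.toℕ-injective (NP.suc-injective (FP.fromℕ<-injective _ _ p q (trans (sym ei) (trans e ej))))
... | inj₂ (li , _) | inj₂ (lj , _) = FP.toℕ-injective (trans li (sym lj))
... | inj₁ (p , ei) | inj₂ (_ , ej)
  with trans (sym (FP.toℕ-fromℕ< p)) (cong toℕ (trans (sym ei) (trans e ej)))
...   | ()
nextMod-injective {suc m} {i} {j} e | inj₂ (_ , ei) | inj₁ (q , ej)
  with trans (sym (FP.toℕ-fromℕ< q)) (cong toℕ (trans (sym ej) (trans (sym e) ei)))
...   | ()

nextMod-fromℕ< : ∀ {m k} (k<n : k < suc m) (1+k<n : suc k < suc m) →
                 nextMod (fromℕ< k<n) ≡ fromℕ< 1+k<n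
nextMod-fromℕ< k<n 1+k<n with nextMod-cases (fromℕ< k<n)
... | inj₁ (p , next≡) = trans next≡ (FP.fromℕ<-cong _ _ (cong suc (FP.toℕ-fromℕ< k<n)) p 1+k<n)
... | inj₂ (last , _)  =
  contradiction (ℕ.s≤s⁻¹ 1+k<n) (NP.<-irrefl (trans (sym (FP.toℕ-fromℕ< k<n)) last))

fold-cancel : ∀ {n} {σ : Fin n → Fin n} → Injective _≡_ _≡_ σ →
              ∀ k {x y} → fold x σ k ≡ fold y σ k → x ≡ y
fold-cancel σ-inj zero    e = e
fold-cancel σ-inj (suc k) e = fold-cancel σ-inj k (σ-inj e)

fold-suc-start : ∀ {n} (σ : Fin n → Fin n) z i → fold (σ z) σ i ≡ fold z σ (suc i)
fold-suc-start σ z zero    = refl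
fold-suc-start σ z (suc i) = cong σ (fold-suc-start σ z i)

-- Under an injective endomap of Fin n every point returns to itself after
-- some d ∈ [1, n] steps (pigeonhole on the first n + 1 iterates).
period : ∀ {n} {σ : Fin n → Fin n} → Injective _≡_ _≡_ σ →
         ∀ z → ∃ λ d → 0 < d × d ≤ n × fold z σ d ≡ z
period {n} {σ} σ-inj z with FP.pigeonhole (NP.n<1+n n) (λ (i : Fin (suc n)) → fold z σ (toℕ i))
... | i , j , i<j , same = toℕ j ∸ toℕ i , NP.m<n⇒0<n∸m i<j
                         , NP.≤-trans (NP.m∸n≤m (toℕ j) (toℕ i)) (ℕ.s≤s⁻¹ (FP.toℕ<n j))
                         , fold-cancel σ-inj (toℕ i) returns
  where
  returns : fold (fold z σ (toℕ j ∸ toℕ i)) σ (toℕ i) ≡ fold z σ (toℕ i)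
  returns = begin
    fold (fold z σ (toℕ j ∸ toℕ i)) σ (toℕ i) ≡⟨ fold-+ z σ (toℕ i) ⟨
    fold z σ (toℕ i + (toℕ j ∸ toℕ i))        ≡⟨ cong (fold z σ) (NP.m+[n∸m]≡n (NP.<⇒≤ i<j)) ⟩
    fold z σ (toℕ j)                           ≡⟨ same ⟨
    fold z σ (toℕ i)                           ∎
    where open ≡-Reasoning

Invariant : ∀ {n} → (Fin n → Fin n) → (Fin n → Set) → Set
Invariant {n} σ S = (u : Fin n) → (S u → S (σ u)) × (S (σ u) → S u)

complement-invariant : ∀ {n} {σ : Fin n → Fin n} {S : Fin n → Set} →
                       Invariant σ S → Invariant σ (λ u → ¬ S u)
complement-invariant invariant u = (λ ¬Su Sσu → ¬Su (proj₂ (invariant u) Sσu))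
                                 , (λ ¬Sσu Su → ¬Sσu (proj₁ (invariant u) Su))

InOrbit : ∀ {n} → (Fin n → Fin n) → Fin n → ℕ → Fin n → Set
InOrbit σ z d w = ∃ λ i → i < d × fold z σ i ≡ w

inOrbit? : ∀ {n} (σ : Fin n → Fin n) z d w → Dec (InOrbit σ z d w)
inOrbit? σ z d w = NP.anyUpTo? (λ i → fold z σ i FP.≟ w) d

orbit-invariant : ∀ {n} {σ : Fin n → Fin n} → Injective _≡_ _≡_ σ →
                  ∀ {z d} → 0 < d → fold z σ d ≡ z → Invariant σ (InOrbit σ z d)
orbit-invariant {σ = σ} σ-inj {z} {suc d′} 0<d returns u = forward , backward
  where
  forward : InOrbit σ z (suc d′) u → InOrbit σ z (suc d′) (σ u)
  forward (i , i<d , refl) with NP.m≤n⇒m<n∨m≡n i<d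
  ... | inj₁ 1+i<d = suc i , 1+i<d , refl
  ... | inj₂ 1+i≡d = 0 , 0<d , trans (sym returns) (cong (fold z σ) (sym 1+i≡d))
  backward : InOrbit σ z (suc d′) (σ u) → InOrbit σ z (suc d′) u
  backward (zero  , _   , z≡σu)   = d′ , NP.n<1+n d′ , σ-inj (trans returns z≡σu)
  backward (suc i , i<d , σⁱ⁺¹z≡σu) = i , NP.<-trans (NP.n<1+n i) i<d , σ-inj σⁱ⁺¹z≡σu

orbit-size : ∀ {n} {σ : Fin n → Fin n} {z d} → (∀ w → InOrbit σ z d w) → n ≤ d
orbit-size {n} {σ} {z} {d} cover = FP.injective⇒≤ {f = index} index-injective
  where
  index : Fin n → Fin d
  index w = fromℕ< (proj₁ (proj₂ (cover w)))
  index-injective : Injective _≡_ _≡_ index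
  index-injective {v} {w} e = begin
    v                          ≡⟨ proj₂ (proj₂ (cover v)) ⟨
    fold z σ (proj₁ (cover v)) ≡⟨ cong (fold z σ) (FP.fromℕ<-injective _ _ _ _ e) ⟩
    fold z σ (proj₁ (cover w)) ≡⟨ proj₂ (proj₂ (cover w)) ⟩
    w                          ∎
    where open ≡-Reasoning

Arcs : ℕ → Set
Arcs n = List (Fin n × Fin n)

combination : ∀ {n} (bs : Arcs n) → (Fin (length bs) → ℚ) → Fin n → ℚ
combination bs c w = sumℚ (map (λ j → c j *ℚ incCol (lookup bs j) w) (allFin (length bs)))

combination-sum : ∀ {n} (bs : Arcs n) c w →
                  combination bs c w ≡ ∑ℚ (λ j → c j *ℚ incCol (lookup bs j) w)
combination-sum bs c w = foldr-map-allFin _+ℚ_ 0ℚ (λ j → c j *ℚ incCol (lookup bs j) w)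

incCol-tail : ∀ {n} (u v : Fin n) → incCol (u , v) u ≡ 1ℚ
incCol-tail u v with u FP.≟ u
... | yes _  = refl
... | no u≢u = contradiction refl u≢u

incCol-head : ∀ {n} (u v : Fin n) → v ≢ u → incCol (u , v) v ≡ - 1ℚ
incCol-head u v v≢u with v FP.≟ u
... | yes v≡u = contradiction v≡u v≢u
... | no _ with v FP.≟ v
...   | yes _  = refl
...   | no v≢v = contradiction refl v≢v

incCol-off : ∀ {n} (u v w : Fin n) → w ≢ u → w ≢ v → incCol (u , v) w ≡ 0ℚ
incCol-off u v w w≢u w≢v with w FP.≟ u
... | yes w≡u = contradiction w≡u w≢u
... | no _ with w FP.≟ v
...   | yes w≡v = contradiction w≡v w≢v
...   | no _    = refl

𝟙 : ∀ {P : Set} → Dec P → ℚ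
𝟙 (yes _) = 1ℚ
𝟙 (no _)  = 0ℚ

𝟙-yes : ∀ {P : Set} (P? : Dec P) → P → 𝟙 P? ≡ 1ℚ
𝟙-yes (yes _) _ = refl
𝟙-yes (no ¬p) p = contradiction p ¬p

𝟙-no : ∀ {P : Set} (P? : Dec P) → ¬ P → 𝟙 P? ≡ 0ℚ
𝟙-no (yes p) ¬p = contradiction p ¬p
𝟙-no (no _)  _  = refl

zero-coefficient : ∀ {a} x → a ≡ 0ℚ → a *ℚ x ≡ 0ℚ
zero-coefficient x refl = QP.*-zeroˡ x

zero-entry : ∀ a {x} → x ≡ 0ℚ → a *ℚ x ≡ 0ℚ
zero-entry a refl = QP.*-zeroʳ a

repeated-arc-dependent : ∀ {n} (bs : Arcs n) {j j'} → j ≢ j' → lookup bs j ≡ lookup bs j' →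
                         ¬ LinIndepArcs bs
repeated-arc-dependent bs {j} {j'} j≢j' same indep = QP.1≢0 (trans (sym c-j) (indep c vanishes j))
  where
  c : Fin (length bs) → ℚ
  c i = 𝟙 (i FP.≟ j) -ℚ 𝟙 (i FP.≟ j')
  c-j : c j ≡ 1ℚ
  c-j = cong₂ _-ℚ_ (𝟙-yes (j FP.≟ j) refl) (𝟙-no (j FP.≟ j') j≢j')
  c-j' : c j' ≡ - 1ℚ
  c-j' = cong₂ _-ℚ_ (𝟙-no (j' FP.≟ j) (j≢j' ∘ sym)) (𝟙-yes (j' FP.≟ j') refl)
  vanishes : ∀ w → combination bs c w ≡ 0ℚ
  vanishes w = begin
    combination bs c w                           ≡⟨ combination-sum bs c w ⟩
    ∑ℚ (λ i → c i *ℚ incCol (lookup bs i) w)     ≡⟨ ℚΣ.sum-pair _ j j' j≢j' others ⟩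
    c j *ℚ x +ℚ c j' *ℚ incCol (lookup bs j') w  ≡⟨ cong (λ b → c j *ℚ x +ℚ c j' *ℚ incCol b w) same ⟨
    c j *ℚ x +ℚ c j' *ℚ x                        ≡⟨ cong₂ (λ a b → a *ℚ x +ℚ b *ℚ x) c-j c-j' ⟩
    1ℚ *ℚ x +ℚ (- 1ℚ) *ℚ x                       ≡⟨ cong (1ℚ *ℚ x +ℚ_) (QP.neg-distribˡ-* 1ℚ x) ⟨
    1ℚ *ℚ x +ℚ - (1ℚ *ℚ x)                       ≡⟨ QP.+-inverseʳ (1ℚ *ℚ x) ⟩
    0ℚ                                           ∎
    where
    open ≡-Reasoning
    x : ℚ
    x = incCol (lookup bs j) w
    others : ∀ i → i ≢ j → i ≢ j' → c i *ℚ incCol (lookup bs i) w ≡ 0ℚ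
    others i i≢j i≢j' =
      zero-coefficient _ (cong₂ _-ℚ_ (𝟙-no (i FP.≟ j) i≢j) (𝟙-no (i FP.≟ j') i≢j'))

-- Columns in echelon form are independent: if column j has entry 1 at a vertex
-- pivot j at which every later column vanishes, then in a vanishing combination
-- each coefficient is zero once all earlier ones are (strong induction on j).
echelon-independent : ∀ {n} (bs : Arcs n) (pivot : Fin (length bs) → Fin n) →
                      (∀ j → incCol (lookup bs j) (pivot j) ≡ 1ℚ) →
                      (∀ j j' → j F.< j' → incCol (lookup bs j') (pivot j) ≡ 0ℚ) →
                      LinIndepArcs bs
echelon-independent bs pivot at-pivot after-pivot c vanishes =
  All.wfRec FI.<-wellFounded _ (λ j → c j ≡ 0ℚ) step
  where
  step : ∀ j → (∀ {j'} → j' F.< j → c j' ≡ 0ℚ) → c j ≡ 0ℚ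
  step j earlier = begin
    c j                                                 ≡⟨ QP.*-identityʳ (c j) ⟨
    c j *ℚ 1ℚ                                           ≡⟨ cong (c j *ℚ_) (at-pivot j) ⟨
    c j *ℚ incCol (lookup bs j) (pivot j)               ≡⟨ ℚΣ.sum-single _ j others ⟨
    ∑ℚ (λ i → c i *ℚ incCol (lookup bs i) (pivot j))    ≡⟨ combination-sum bs c (pivot j) ⟨
    combination bs c (pivot j)                          ≡⟨ vanishes (pivot j) ⟩
    0ℚ                                                  ∎
    where
    open ≡-Reasoning
    others : ∀ i → i ≢ j → c i *ℚ incCol (lookup bs i) (pivot j) ≡ 0ℚ
    others i i≢j with FP.<-cmp i j
    ... | tri< i<j _ _ = zero-coefficient _ (earlier i<j)
    ... | tri≈ _ i≡j _ = contradiction i≡j i≢j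
    ... | tri> _ _ j<i = zero-entry (c i) (after-pivot j i j<i)

SuccessorList : ∀ {n} → (Fin n → Fin n) → Arcs n → Set
SuccessorList σ bs = ∀ b → b ∈ bs → proj₂ b ≡ σ (proj₁ b)

walk : ∀ {n} → (Fin n → Fin n) → ℕ → Fin n → Arcs n
walk σ zero    z = []
walk σ (suc k) z = (z , σ z) ∷ walk σ k (σ z)

walk-length : ∀ {n} (σ : Fin n → Fin n) k z → length (walk σ k z) ≡ k
walk-length σ zero    z = refl
walk-length σ (suc k) z = cong suc (walk-length σ k (σ z))

walk-successor : ∀ {n} (σ : Fin n → Fin n) k z → SuccessorList σ (walk σ k z)
walk-successor σ (suc k) z b (here refl) = refl
walk-successor σ (suc k) z b (there b∈) = walk-successor σ k (σ z) b b∈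

walk-lookup : ∀ {n} (σ : Fin n → Fin n) k z (j : Fin (length (walk σ k z))) →
              lookup (walk σ k z) j ≡ (fold z σ (toℕ j) , fold z σ (suc (toℕ j)))
walk-lookup σ (suc k) z F.zero    = refl
walk-lookup σ (suc k) z (F.suc j) = trans (walk-lookup σ k (σ z) j)
  (cong₂ _,_ (fold-suc-start σ z (toℕ j)) (fold-suc-start σ z (suc (toℕ j))))

-- The arcs of a walk visiting pairwise distinct vertices are independent:
-- they are in echelon form with pivot j = σʲ z.
walk-independent : ∀ {n} (σ : Fin n → Fin n) k z →
                   (∀ i i' → i ≤ k → i' ≤ k → fold z σ i ≡ fold z σ i' → i ≡ i') →
                   LinIndepArcs (walk σ k z)
walk-independent {n} σ k z distinct = echelon-independent bs (λ j → fold z σ (toℕ j)) at-pivot after-pivot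
  where
  bs : Arcs n
  bs = walk σ k z
  bound : ∀ (j : Fin (length bs)) → toℕ j < k
  bound j = subst (toℕ j <_) (walk-length σ k z) (FP.toℕ<n j)
  at-pivot : ∀ j → incCol (lookup bs j) (fold z σ (toℕ j)) ≡ 1ℚ
  at-pivot j = trans (cong (λ b → incCol b (fold z σ (toℕ j))) (walk-lookup σ k z j))
    (incCol-tail (fold z σ (toℕ j)) (fold z σ (suc (toℕ j))))
  after-pivot : ∀ j j' → j F.< j' → incCol (lookup bs j') (fold z σ (toℕ j)) ≡ 0ℚ
  after-pivot j j' j<j' = trans (cong (λ b → incCol b (fold z σ (toℕ j))) (walk-lookup σ k z j'))
    (incCol-off _ _ _
      (λ e → NP.<-irrefl (distinct _ _ (NP.<⇒≤ (bound j)) (NP.<⇒≤ (bound j')) e) j<j')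
      (λ e → NP.<-irrefl (distinct _ _ (NP.<⇒≤ (bound j)) (bound j') e) (NP.m<n⇒m<1+n j<j')))

module SuccessorRank {m} (σ : Fin (suc m) → Fin (suc m))
                     (σ-injective : Injective _≡_ _≡_ σ) (σ-loopless : ∀ u → σ u ≢ u) where

  tails : (bs : Arcs (suc m)) → Fin (length bs) → Fin (suc m)
  tails bs j = proj₁ (lookup bs j)

  arc-by-tail : ∀ {bs} → SuccessorList σ bs → ∀ j → lookup bs j ≡ (tails bs j , σ (tails bs j))
  arc-by-tail {bs} succ j = cong (tails bs j ,_) (succ _ (∈-lookup j))

  tails-injective : ∀ {bs} → SuccessorList σ bs → LinIndepArcs bs → Injective _≡_ _≡_ (tails bs)
  tails-injective {bs} succ indep {j} {j'} same-tail with j FP.≟ j'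
  ... | yes j≡j' = j≡j'
  ... | no j≢j'  = contradiction indep (repeated-arc-dependent bs j≢j' same-arc)
    where
    same-arc : lookup bs j ≡ lookup bs j'
    same-arc = trans (arc-by-tail succ j)
                 (trans (cong (λ u → u , σ u) same-tail) (sym (arc-by-tail succ j')))

  tail-indicator : (bs : Arcs (suc m)) {S : Fin (suc m) → Set} → (∀ u → Dec (S u)) →
                   Fin (length bs) → ℚ
  tail-indicator bs S? j = 𝟙 (S? (tails bs j))

  -- If every vertex of a σ-invariant set S is a tail of a successor list with
  -- distinct tails, the columns with tail in S sum to zero: at a vertex w ∈ S only
  -- the arcs w → σ w (entry 1) and σ⁻¹ w → w (entry −1) contribute, and at a
  -- vertex outside S no such column has a nonzero entry.
  invariant-columns-cancel :
    ∀ {bs} → SuccessorList σ bs → Injective _≡_ _≡_ (tails bs) →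
    ∀ {S : Fin (suc m) → Set} (S? : ∀ u → Dec (S u)) → Invariant σ S →
    (∀ u → S u → Hits (tails bs) u) → ∀ w → combination bs (tail-indicator bs S?) w ≡ 0ℚ
  invariant-columns-cancel {bs} succ tails-inj {S} S? invariant cover w with S? w
  ... | yes Sw = trans (combination-sum bs c w) (inside Sw)
    where
    c : Fin (length bs) → ℚ
    c = tail-indicator bs S?
    pred-w : Hits σ w
    pred-w = injective⇒surjective σ σ-injective NP.≤-refl w
    u : Fin (suc m)
    u = proj₁ pred-w
    σu≡w : σ u ≡ w
    σu≡w = proj₂ pred-w
    out : Fin (length bs)
    out = proj₁ (cover w Sw)
    out-tail : tails bs out ≡ w
    out-tail = proj₂ (cover w Sw)
    Su : S u
    Su = proj₂ (invariant u) (subst S (sym σu≡w) Sw)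
    in′ : Fin (length bs)
    in′ = proj₁ (cover u Su)
    in-tail : tails bs in′ ≡ u
    in-tail = proj₂ (cover u Su)
    out-entry : incCol (lookup bs out) w ≡ 1ℚ
    out-entry = trans (cong (λ b → incCol b w) (arc-by-tail succ out))
      (trans (cong (λ t → incCol (t , σ t) w) out-tail) (incCol-tail w (σ w)))
    in-entry : incCol (lookup bs in′) w ≡ - 1ℚ
    in-entry = trans (cong (λ b → incCol b w) (arc-by-tail succ in′))
      (trans (cong (λ t → incCol (t , σ t) w) in-tail)
        (trans (cong (incCol (u , σ u)) (sym σu≡w)) (incCol-head u (σ u) (σ-loopless u))))
    out≢in : out ≢ in′
    out≢in e = σ-loopless u (trans σu≡w (trans (sym out-tail) (trans (cong (tails bs) e) in-tail)))
    others : ∀ j → j ≢ out → j ≢ in′ → c j *ℚ incCol (lookup bs j) w ≡ 0ℚ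
    others j j≢out j≢in = zero-entry (c j) (trans (cong (λ b → incCol b w) (arc-by-tail succ j))
      (incCol-off _ _ w
        (λ w≡t → j≢out (tails-inj (trans (sym w≡t) (sym out-tail))))
        (λ w≡σt → j≢in (tails-inj (σ-injective
                    (trans (sym w≡σt) (trans (sym σu≡w) (cong σ (sym in-tail)))))))))
    inside : S w → ∑ℚ (λ j → c j *ℚ incCol (lookup bs j) w) ≡ 0ℚ
    inside Sw = begin
      ∑ℚ (λ j → c j *ℚ incCol (lookup bs j) w)    ≡⟨ ℚΣ.sum-pair _ out in′ out≢in others ⟩
      c out *ℚ incCol (lookup bs out) w +ℚ c in′ *ℚ incCol (lookup bs in′) w
        ≡⟨ cong₂ _+ℚ_ (cong₂ _*ℚ_ (𝟙-yes (S? _) (subst S (sym out-tail) Sw)) out-entry)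
                      (cong₂ _*ℚ_ (𝟙-yes (S? _) (subst S (sym in-tail) Su)) in-entry) ⟩
      1ℚ *ℚ 1ℚ +ℚ 1ℚ *ℚ (- 1ℚ)                    ≡⟨⟩
      0ℚ                                          ∎
      where open ≡-Reasoning
  ... | no ¬Sw = trans (combination-sum bs (tail-indicator bs S?) w) (ℚΣ.sum-zero _ outside)
    where
    outside : ∀ j → tail-indicator bs S? j *ℚ incCol (lookup bs j) w ≡ 0ℚ
    outside j with S? (tails bs j)
    ... | no _   = QP.*-zeroˡ (incCol (lookup bs j) w)
    ... | yes St = zero-entry 1ℚ (trans (cong (λ b → incCol b w) (arc-by-tail succ j)) (incCol-off _ _ w
                     (λ w≡t → ¬Sw (subst S (sym w≡t) St))
                     (λ w≡σt → ¬Sw (subst S (sym w≡σt) (proj₁ (invariant _) St)))))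

  covered-invariant-dependent :
    ∀ {bs} → SuccessorList σ bs → Injective _≡_ _≡_ (tails bs) →
    ∀ {S : Fin (suc m) → Set} (S? : ∀ u → Dec (S u)) → Invariant σ S →
    (∀ u → S u → Hits (tails bs) u) → ∀ {s} → S s → ¬ LinIndepArcs bs
  covered-invariant-dependent {bs} succ tails-inj {S} S? invariant cover {s} Ss indep =
    QP.1≢0 (trans (sym (𝟙-yes (S? _) (subst S (sym (proj₂ (cover s Ss))) Ss)))
                  (indep (tail-indicator bs S?) (invariant-columns-cancel succ tails-inj S? invariant cover)
                         (proj₁ (cover s Ss))))

  -- A successor list on suc m vertices has at most m independent arcs: with
  -- suc m of them every vertex is a tail, and the whole vertex set is invariant.
  independent-bound : ∀ {bs} → SuccessorList σ bs → LinIndepArcs bs → length bs ≤ m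
  independent-bound {bs} succ indep =
    ℕ.s≤s⁻¹ (NP.≤∧≢⇒< (FP.injective⇒≤ {f = tails bs} tails-inj) not-all)
    where
    tails-inj : Injective _≡_ _≡_ (tails bs)
    tails-inj = tails-injective succ indep
    not-all : length bs ≢ suc m
    not-all len = covered-invariant-dependent succ tails-inj {S = λ _ → ⊤} (λ _ → yes tt)
      (λ _ → (λ _ → tt) , (λ _ → tt))
      (λ u _ → injective⇒surjective (tails bs) tails-inj (NP.≤-reflexive (sym len)) u) {F.zero} tt indep

  -- With m independent arcs, every nonempty decidable σ-invariant set is everything:
  -- otherwise it or its (nonempty, invariant) complement would be covered by tails.
  invariant-full : ∀ {bs} → SuccessorList σ bs → LinIndepArcs bs → length bs ≡ m →
                   ∀ {S : Fin (suc m) → Set} (S? : ∀ u → Dec (S u)) → Invariant σ S →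
                   ∀ {s} → S s → ∀ w → S w
  invariant-full {bs} succ indep len {S} S? invariant Ss w with S? w
  ... | yes Sw = Sw
  ... | no ¬Sw = contradiction indep (one-side-dependent
          (injective-covers-side (tails bs) tails-inj (NP.≤-reflexive (sym len)) S?))
    where
    tails-inj : Injective _≡_ _≡_ (tails bs)
    tails-inj = tails-injective succ indep
    one-side-dependent : (∀ u → S u → Hits (tails bs) u) ⊎ (∀ u → ¬ S u → Hits (tails bs) u) →
                         ¬ LinIndepArcs bs
    one-side-dependent (inj₁ S-covered) =
      covered-invariant-dependent succ tails-inj S? invariant S-covered Ss
    one-side-dependent (inj₂ ∁S-covered) =
      covered-invariant-dependent succ tails-inj (¬? ∘ S?) (complement-invariant invariant) ∁S-covered ¬Sw

record SuccessorOf {n} (L : Digraph n) (σ : Fin n → Fin n) : Set where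
  field
    arc    : ∀ u → L u (σ u) ≡ true
    unique : ∀ {u v} → L u v ≡ true → v ≡ σ u
open SuccessorOf

successor-list : ∀ {n} {L : Digraph n} {σ bs} → SuccessorOf L σ → ArcListOf L bs →
                 SuccessorList σ bs
successor-list succ arcs b b∈bs = unique succ (arcs b b∈bs)

loopless : ∀ {n} {A L : Digraph n} {σ} → Simple A → L ⊆ᵃ A → SuccessorOf L σ →
           ∀ u → σ u ≢ u
loopless {L = L} simple L⊆A succ u σu≡u
  with trans (sym (simple u)) (L⊆A u u (subst (λ v → L u v ≡ true) σu≡u (arc succ u)))
... | ()

indicator : Bool → ℕ
indicator b = if b then 1 else 0

outdegree : ∀ {n} → (Fin n → Fin n → Bool) → Fin n → ℕ
outdegree M i = ∑ℕ (λ k → indicator (M i k))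

countB-outdegree : ∀ {n} (M : Fin n → Fin n → Bool) → countB M ≡ ∑ℕ (outdegree M)
countB-outdegree {n} M =
  trans (foldr-map-allFin _+_ 0 (λ i → foldr _+_ 0 (map (λ k → indicator (M i k)) (allFin n))))
        (ℕΣ.sum-cong-≗ (λ i → foldr-map-allFin _+_ 0 (λ k → indicator (M i k))))

outdegree-single : ∀ {n} (M : Fin n → Fin n → Bool) i k₀ → (∀ k → M i k ≡ true → k ≡ k₀) →
                   outdegree M i ≡ indicator (M i k₀)
outdegree-single M i k₀ only = ℕΣ.sum-single _ k₀ off
  where
  off : ∀ k → k ≢ k₀ → indicator (M i k) ≡ 0
  off k k≢k₀ with M i k in Mik
  ... | true  = contradiction (only k Mik) k≢k₀
  ... | false = refl

outdegree-empty : ∀ {n} (M : Fin n → Fin n → Bool) i → ¬ (∃ λ k → M i k ≡ true) →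
                  outdegree M i ≡ 0
outdegree-empty M i none = ℕΣ.sum-zero _ off
  where
  off : ∀ k → indicator (M i k) ≡ 0
  off k with M i k in Mik
  ... | true  = contradiction (k , Mik) none
  ... | false = refl

successor⇒matching : ∀ {n} {A L : Digraph n} {σ} → L ⊆ᵃ A → SuccessorOf L σ →
                     Injective _≡_ _≡_ σ →
                     IsPerfectMatching (ZMapping A) (correspondingEdges L)
successor⇒matching {n} {L = L} {σ} L⊆A succ σ-inj = L⊆A , size , disjoint
  where
  size : countB L ≡ n
  size = trans (countB-outdegree L)
    (sum-ones (outdegree L) (λ i → trans (outdegree-single L i (σ i) (λ k → unique succ))
                                           (cong indicator (arc succ i))))
  disjoint : ∀ i k i' k' → L i k ≡ true → L i' k' ≡ true → ¬ ((i , k) ≡ (i' , k')) →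
             ¬ i ≡ i' × ¬ k ≡ k'
  disjoint i k i' k' Lik Li'k' distinct =
      (λ i≡i' → distinct (cong₂ _,_ i≡i' (trans k≡σi (trans (cong σ i≡i') (sym k'≡σi')))))
    , (λ k≡k' → distinct (cong₂ _,_ (σ-inj (trans (sym k≡σi) (trans k≡k' k'≡σi'))) k≡k'))
    where
    k≡σi : k ≡ σ i
    k≡σi = unique succ Lik
    k'≡σi' : k' ≡ σ i'
    k'≡σi' = unique succ Li'k'

matching⇒successor : ∀ {n} {A L : Digraph n} → IsPerfectMatching (ZMapping A) (correspondingEdges L) →
                     ∃ λ σ → SuccessorOf L σ × Injective _≡_ _≡_ σ
matching⇒successor {n} {L = L} (_ , size , disjoint) =
  σ , record { arc = arc′ ; unique = unique′ } , σ-inj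
  where
  functional : ∀ {i k k'} → L i k ≡ true → L i k' ≡ true → k ≡ k'
  functional {i} {k} {k'} Lik Lik' with k FP.≟ k'
  ... | yes k≡k' = k≡k'
  ... | no k≢k'  = contradiction refl (proj₁ (disjoint i k i k' Lik Lik' (k≢k' ∘ cong proj₂)))
  outdegree≤1 : ∀ i → outdegree L i ≤ 1
  outdegree≤1 i with FP.any? (λ k → L i k BP.≟ true)
  ... | yes (k , Lik) = NP.≤-reflexive (trans (outdegree-single L i k (λ k' Lik' → functional Lik' Lik))
                                              (cong indicator Lik))
  ... | no none = NP.≤-trans (NP.≤-reflexive (outdegree-empty L i none)) z≤n
  -- n edges, at most one at each x_i: exactly one at each x_i
  has-arc : ∀ i → ∃ λ k → L i k ≡ true
  has-arc i with FP.any? (λ k → L i k BP.≟ true)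
  ... | yes found = found
  ... | no none   = contradiction (trans (sym (outdegree-empty L i none))
                      (saturated (outdegree L) outdegree≤1 (trans (sym (countB-outdegree L)) size) i)) λ ()
  σ : Fin n → Fin n
  σ i = proj₁ (has-arc i)
  arc′ : ∀ u → L u (σ u) ≡ true
  arc′ u = proj₂ (has-arc u)
  unique′ : ∀ {u v} → L u v ≡ true → v ≡ σ u
  unique′ Luv = functional Luv (arc′ _)
  σ-inj : Injective _≡_ _≡_ σ
  σ-inj {u} {u'} σu≡σu' with u FP.≟ u'
  ... | yes u≡u' = u≡u'
  ... | no u≢u'  =
    contradiction σu≡σu' (proj₂ (disjoint u (σ u) u' (σ u') (arc′ u) (arc′ u') (u≢u' ∘ cong proj₁)))

CyclicOrder : ∀ {n} → (σ π : Fin n → Fin n) → Set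
CyclicOrder σ π = Injective _≡_ _≡_ π × (∀ i → π (nextMod i) ≡ σ (π i))

-- A Hamiltonian cycle π is a cyclic order of the successor function π ∘ nextMod ∘ π⁻¹.
ham⇒cyclic : ∀ {n} {L : Digraph n} → IsHamCycleArcSet L →
             ∃₂ λ σ π → SuccessorOf L σ × CyclicOrder σ π
ham⇒cyclic {n} {L} (π , π-inj , arcs) =
  σ , π , record { arc = arc′ ; unique = unique′ } , π-inj , step
  where
  position : Fin n → Fin n
  position u = proj₁ (injective⇒surjective π π-inj NP.≤-refl u)
  π∘position : ∀ u → π (position u) ≡ u
  π∘position u = proj₂ (injective⇒surjective π π-inj NP.≤-refl u)
  position∘π : ∀ i → position (π i) ≡ i
  position∘π i = π-inj (π∘position (π i))
  σ : Fin n → Fin n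
  σ u = π (nextMod (position u))
  arc′ : ∀ u → L u (σ u) ≡ true
  arc′ u = proj₂ (arcs u (σ u)) (position u , π∘position u , refl)
  unique′ : ∀ {u v} → L u v ≡ true → v ≡ σ u
  unique′ {u} {v} Luv with proj₁ (arcs u v) Luv
  ... | i , πi≡u , πnext≡v =
    trans (sym πnext≡v) (cong (π ∘ nextMod) (trans (sym (position∘π i)) (cong position πi≡u)))
  step : ∀ i → π (nextMod i) ≡ σ (π i)
  step i = cong (π ∘ nextMod) (sym (position∘π i))

cyclic⇒ham : ∀ {n} {L : Digraph n} {σ π} → SuccessorOf L σ → CyclicOrder σ π →
             IsHamCycleArcSet L
cyclic⇒ham {L = L} {σ} {π} succ (π-inj , step) = π , π-inj , λ u v → along u v , back u v
  where
  along : ∀ u v → L u v ≡ true → ∃ λ i → π i ≡ u × π (nextMod i) ≡ v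
  along u v Luv with injective⇒surjective π π-inj NP.≤-refl u
  ... | i , πi≡u = i , πi≡u , trans (step i) (trans (cong σ πi≡u) (sym (unique succ Luv)))
  back : ∀ u v → (∃ λ i → π i ≡ u × π (nextMod i) ≡ v) → L u v ≡ true
  back u v (i , πi≡u , πnext≡v) =
    subst (λ w → L u w ≡ true) (trans (cong σ (sym πi≡u)) (trans (sym (step i)) πnext≡v)) (arc succ u)

cyclic⇒injective : ∀ {n} {σ π : Fin n → Fin n} → CyclicOrder σ π → Injective _≡_ _≡_ σ
cyclic⇒injective {σ = σ} {π} (π-inj , step) {x} {y} σx≡σy
  with injective⇒surjective π π-inj NP.≤-refl x | injective⇒surjective π π-inj NP.≤-refl y
... | i , refl | j , refl =
  cong π (nextMod-injective (π-inj (trans (step i) (trans σx≡σy (sym (step j))))))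

cyclic-iterates : ∀ {m} {σ π : Fin (suc m) → Fin (suc m)} → CyclicOrder σ π →
                  ∀ k (k<n : k < suc m) → fold (π F.zero) σ k ≡ π (fromℕ< k<n)
cyclic-iterates order zero    k<n = refl
cyclic-iterates {m} {σ} {π} (π-inj , step) (suc k) 1+k<n = begin
  σ (fold (π F.zero) σ k)   ≡⟨ cong σ (cyclic-iterates (π-inj , step) k k<n) ⟩
  σ (π (fromℕ< k<n))        ≡⟨ step (fromℕ< k<n) ⟨
  π (nextMod (fromℕ< k<n))  ≡⟨ cong π (nextMod-fromℕ< k<n 1+k<n) ⟩
  π (fromℕ< 1+k<n)          ∎
  where
  open ≡-Reasoning
  k<n : k < suc m
  k<n = NP.<-trans (NP.n<1+n k) 1+k<n

orbit⇒cyclic : ∀ {m} {σ : Fin (suc m) → Fin (suc m)} {z} → fold z σ (suc m) ≡ z →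
               (∀ w → InOrbit σ z (suc m) w) → CyclicOrder σ (λ i → fold z σ (toℕ i))
orbit⇒cyclic {m} {σ} {z} returns cover = surjective⇒injective π onto , step
  where
  π : Fin (suc m) → Fin (suc m)
  π i = fold z σ (toℕ i)
  onto : ∀ w → Hits π w
  onto w with cover w
  ... | i , i<n , σⁱz≡w = fromℕ< i<n , trans (cong (fold z σ) (FP.toℕ-fromℕ< i<n)) σⁱz≡w
  step : ∀ i → π (nextMod i) ≡ σ (π i)
  step i with nextMod-cases i
  ... | inj₁ (p , next≡)     = trans (cong π next≡) (cong (fold z σ) (FP.toℕ-fromℕ< p))
  ... | inj₂ (last , next≡0) =
    trans (cong π next≡0) (trans (sym returns) (cong (fold z σ ∘ suc) (sym last)))

cyclic-rank : ∀ {m} {L : Digraph (suc m)} {σ π} → SuccessorOf L σ → (∀ u → σ u ≢ u) →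
              CyclicOrder σ π → IncidenceRank L m
cyclic-rank {m} {L} {σ} {π} succ σ-loopless order@(π-inj , _) =
    (path , path-arcs , walk-independent σ m (π F.zero) distinct , walk-length σ m (π F.zero))
  , λ bs arcs indep → independent-bound (successor-list succ arcs) indep
  where
  path : Arcs (suc m)
  path = walk σ m (π F.zero)
  open SuccessorRank σ (cyclic⇒injective {σ = σ} order) σ-loopless
  path-arcs : ArcListOf L path
  path-arcs b b∈path =
    subst (λ v → L (proj₁ b) v ≡ true) (sym (walk-successor σ m (π F.zero) b b∈path)) (arc succ (proj₁ b))
  distinct : ∀ i i' → i ≤ m → i' ≤ m → fold (π F.zero) σ i ≡ fold (π F.zero) σ i' → i ≡ i'
  distinct i i' i≤m i'≤m σⁱ≡σⁱ' = FP.fromℕ<-injective i i' (s≤s i≤m) (s≤s i'≤m)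
    (π-inj (trans (sym (cyclic-iterates order i (s≤s i≤m)))
                  (trans σⁱ≡σⁱ' (cyclic-iterates order i' (s≤s i'≤m)))))

rank⇒cyclic : ∀ {m} {σ : Fin (suc m) → Fin (suc m)} {bs} →
              Injective _≡_ _≡_ σ → (∀ u → σ u ≢ u) →
              SuccessorList σ bs → LinIndepArcs bs → length bs ≡ m → ∃ λ π → CyclicOrder σ π
rank⇒cyclic {m} {σ} σ-inj σ-loopless succ indep len with period σ-inj F.zero
... | d , 0<d , d≤n , returns = _ , orbit⇒cyclic (subst (λ k → fold F.zero σ k ≡ F.zero) d≡n returns)
                                                 (subst (λ k → ∀ w → InOrbit σ F.zero k w) d≡n cover)
  where
  open SuccessorRank σ σ-inj σ-loopless
  cover : ∀ w → InOrbit σ F.zero d w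
  cover = invariant-full succ indep len (inOrbit? σ F.zero d) (orbit-invariant σ-inj 0<d returns)
                         (0 , 0<d , refl)
  d≡n : d ≡ suc m
  d≡n = NP.≤-antisym d≤n (orbit-size cover)

lemma4 : (n : ℕ) → 2 ≤ n → (A : Digraph n) → Simple A →
    (L : Digraph n) → L ⊆ᵃ A →
    IsHamCycleArcSet L ⇔
      (IsPerfectMatching (ZMapping A) (correspondingEdges L) × IncidenceRank L (n ∸ 1))
lemma4 (suc (suc m)) (s≤s (s≤s z≤n)) A simple L L⊆A = mk⇔ forward backward
  where
  forward : IsHamCycleArcSet L →
            IsPerfectMatching (ZMapping A) (correspondingEdges L) × IncidenceRank L (suc m)
  forward ham with ham⇒cyclic ham
  ... | σ , π , succ , order = successor⇒matching L⊆A succ (cyclic⇒injective order)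
                             , cyclic-rank succ (loopless simple L⊆A succ) order
  backward : IsPerfectMatching (ZMapping A) (correspondingEdges L) × IncidenceRank L (suc m) →
             IsHamCycleArcSet L
  backward (matching , (bs , arcs , indep , len) , _) with matching⇒successor matching
  ... | σ , succ , σ-inj = cyclic⇒ham succ (proj₂
          (rank⇒cyclic σ-inj (loopless simple L⊆A succ) (successor-list succ arcs) indep len))
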